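{- For every $s\in\mathbb N$, the sum $T_2^1\oplus\cdots\oplus T_2^s$ of $s$ copies of $T_2$ contains (as a subdigraph) every tournament on at most $2s$ vertices, and the sum $T_1\oplus T_2^1\oplus\cdots\oplus T_2^s$ of one copy of $T_1$ and $s$ copies of $T_2$ contains every tournament on at most $2s+1$ vertices.
   Context: A digraph has a vertex set and arcs that are ordered pairs of distinct vertices (both $(u,v),(v,u)$ allowed). A tournament is a digraph with exactly one arc between every two distinct vertices. $T_1$ is the one-vertex digraph and $T_2$ is the unique tournament on two vertices (a single arc). For vertex-disjoint digraphs $D,D'$, the sum $D\oplus D'$ is the digraph on $V(D)\cup V(D')$ with arc set $A(D)\cup A(D')\cup(V(D)\times V(D'))\cup(V(D')\times V(D))$; sums of several digraphs are taken iteratively on vertex-disjoint copies. -}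

module Defs where

open import Data.Nat using (ℕ; zero; suc; _+_)
open import Data.Fin using (Fin; zero; suc; splitAt)
open import Data.Sum using (_⊎_; inj₁; inj₂)
open import Data.Product using (Σ; _×_; _,_)
open import Data.Empty using (⊥)
open import Data.Unit using (⊤)
open import Relation.Nullary using (¬_)
open import Relation.Binary.PropositionalEquality using (_≡_)
open import Function.Definitions using (Injective)

record Digraph (n : ℕ) : Set₁ where
  field
    Arc   : Fin n → Fin n → Set
    loopless : ∀ v → ¬ Arc v v
open Digraph public

IsTournament : ∀ {n} → Digraph n → Set
IsTournament {n} D =
  ∀ (u v : Fin n) → ¬ (u ≡ v) →
    (Arc D u v ⊎ Arc D v u) × ¬ (Arc D u v × Arc D v u)

_⊆D_ : ∀ {m n} → Digraph m → Digraph n → Set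
_⊆D_ {m} {n} D E =
  Σ (Fin m → Fin n) λ f → Injective _≡_ _≡_ f ×
    (∀ u v → Arc D u v → Arc E (f u) (f v))

sumArc : ∀ {m n} → Digraph m → Digraph n →
         Fin m ⊎ Fin n → Fin m ⊎ Fin n → Set
sumArc D D' (inj₁ a) (inj₁ b) = Arc D a b
sumArc D D' (inj₂ a) (inj₂ b) = Arc D' a b
sumArc D D' (inj₁ a) (inj₂ b) = ⊤
sumArc D D' (inj₂ a) (inj₁ b) = ⊤

sumLoopless : ∀ {m n} (D : Digraph m) (D' : Digraph n) →
              ∀ x → ¬ sumArc D D' x x
sumLoopless D D' (inj₁ a) = loopless D a
sumLoopless D D' (inj₂ a) = loopless D' a

_⊕_ : ∀ {m n} → Digraph m → Digraph n → Digraph (m + n)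
_⊕_ {m} D D' = record
  { Arc = λ u v → sumArc D D' (splitAt m u) (splitAt m v)
  ; loopless = λ v → sumLoopless D D' (splitAt m v)
  }

D₀ : Digraph 0
D₀ = record { Arc = λ () ; loopless = λ () }

T₁ : Digraph 1
T₁ = record { Arc = λ _ _ → ⊥ ; loopless = λ _ () }

T₂Arc : Fin 2 → Fin 2 → Set
T₂Arc zero (suc zero) = ⊤
T₂Arc _ _ = ⊥

T₂loop : ∀ v → ¬ T₂Arc v v
T₂loop zero ()
T₂loop (suc zero) ()

T₂ : Digraph 2
T₂ = record { Arc = T₂Arc ; loopless = T₂loop }

twice : ℕ → ℕ
twice zero = 0
twice (suc s) = 2 + twice s

sumT₂ : (s : ℕ) → Digraph (twice s)
sumT₂ zero = D₀
sumT₂ (suc s) = T₂ ⊕ sumT₂ s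

-- In a sum D ⊕ D' every arc between the two parts is present in both
-- directions, so a digraph on Fin (m + n) embeds into D ⊕ D' as soon as its
-- first m vertices embed into D and its last n vertices embed into D'.
-- A tournament on two vertices is a copy of T₂ and one on a single vertex a
-- copy of T₁, so peeling off two vertices at a time (one for the T₁ summand)
-- embeds every small enough tournament.
module Submission where

open import Defs
open import Data.Nat using (ℕ; zero; suc; _+_; _*_; _≤_; s≤s)
open import Data.Nat.Properties using (*-distribˡ-+)
open import Data.Fin using (Fin; zero; suc; _↑ˡ_; _↑ʳ_; splitAt; join; opposite)
open import Data.Fin.Properties using (↑ˡ-injective; ↑ʳ-injective; splitAt-join; join-splitAt)
open import Data.Sum using (inj₁; inj₂)
import Data.Sum as Sum
open import Data.Sum.Properties using (inj₁-injective; inj₂-injective)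
open import Data.Product using (_×_; _,_)
open import Data.Unit using (tt)
open import Data.Empty using (⊥-elim)
open import Function using (_∘_; id)
open import Function.Definitions using (Injective)
open import Relation.Binary.PropositionalEquality
  using (_≡_; refl; sym; trans; cong; subst₂)

induced : ∀ {m n} → (Fin m → Fin n) → Digraph n → Digraph m
induced ι T = record
  { Arc = λ u v → Arc T (ι u) (ι v)
  ; loopless = λ v → loopless T (ι v)
  }

induced-isTournament : ∀ {m n} {ι : Fin m → Fin n} →
                       Injective _≡_ _≡_ ι → (T : Digraph n) → IsTournament T →
                       IsTournament (induced ι T)
induced-isTournament ι-inj T tT u v u≢v = tT _ _ (u≢v ∘ ι-inj)

empty-⊆D : ∀ {k} (T : Digraph 0) (E : Digraph k) → T ⊆D E
empty-⊆D T E = (λ ()) , (λ { {()} }) , (λ ())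

single-⊆D : ∀ {k} (T : Digraph 1) (E : Digraph (suc k)) → T ⊆D E
single-⊆D {k} T E = (λ _ → zero) , injective , arc
  where
  arc : ∀ u v → Arc T u v → Arc E zero zero
  arc zero zero a = ⊥-elim (loopless T zero a)
  injective : Injective _≡_ _≡_ (λ (_ : Fin 1) → zero {k})
  injective {zero} {zero} _ = refl

tournament₂-⊆D-T₂ : (T : Digraph 2) → IsTournament T → T ⊆D T₂
tournament₂-⊆D-T₂ T tT with tT zero (suc zero) (λ ())
... | inj₁ 0→1 , not-both = id , id , arc
  where
  arc : ∀ u v → Arc T u v → T₂Arc u v
  arc zero       zero       a = loopless T zero a
  arc zero       (suc zero) _ = tt
  arc (suc zero) zero       a = not-both (0→1 , a)
  arc (suc zero) (suc zero) a = loopless T (suc zero) a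
... | inj₂ 1→0 , not-both = opposite , injective , arc
  where
  injective : Injective _≡_ _≡_ (opposite {2})
  injective {zero}     {zero}     _ = refl
  injective {zero}     {suc zero} ()
  injective {suc zero} {zero}     ()
  injective {suc zero} {suc zero} _ = refl
  arc : ∀ u v → Arc T u v → T₂Arc (opposite u) (opposite v)
  arc zero       zero       a = loopless T zero a
  arc zero       (suc zero) a = not-both (a , 1→0)
  arc (suc zero) zero       _ = tt
  arc (suc zero) (suc zero) a = loopless T (suc zero) a

splitAt-injective : ∀ m {n} → Injective _≡_ _≡_ (splitAt m {n})
splitAt-injective m {n} {u} {v} eq =
  trans (sym (join-splitAt m n u)) (trans (cong (join m n) eq) (join-splitAt m n v))

join-injective : ∀ m n → Injective _≡_ _≡_ (join m n)
join-injective m n {x} {y} eq =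
  trans (sym (splitAt-join m n x)) (trans (cong (splitAt m) eq) (splitAt-join m n y))

⊆D-⊕ : ∀ {m n m′ n′} (T : Digraph (m + n))
       {D : Digraph m′} {D′ : Digraph n′} →
       induced (_↑ˡ n) T ⊆D D → induced (m ↑ʳ_) T ⊆D D′ → T ⊆D (D ⊕ D′)
⊆D-⊕ {m} {n} {m′} {n′} T {D} {D′} (f , f-inj , f-arc) (g , g-inj , g-arc) =
  embed , embed-injective , embed-arc
  where
  f⊎g = Sum.map f g

  f⊎g-injective : Injective _≡_ _≡_ f⊎g
  f⊎g-injective {inj₁ _} {inj₁ _} eq = cong inj₁ (f-inj (inj₁-injective eq))
  f⊎g-injective {inj₂ _} {inj₂ _} eq = cong inj₂ (g-inj (inj₂-injective eq))
  f⊎g-injective {inj₁ _} {inj₂ _} ()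
  f⊎g-injective {inj₂ _} {inj₁ _} ()

  embed : Fin (m + n) → Fin (m′ + n′)
  embed = join m′ n′ ∘ f⊎g ∘ splitAt m

  embed-injective : Injective _≡_ _≡_ embed
  embed-injective = splitAt-injective m ∘ f⊎g-injective ∘ join-injective m′ n′

  arc-⊎ : ∀ x y → Arc T (join m n x) (join m n y) → sumArc D D′ (f⊎g x) (f⊎g y)
  arc-⊎ (inj₁ a) (inj₁ b) = f-arc a b
  arc-⊎ (inj₂ a) (inj₂ b) = g-arc a b
  arc-⊎ (inj₁ _) (inj₂ _) _ = tt
  arc-⊎ (inj₂ _) (inj₁ _) _ = tt

  embed-arc : ∀ u v → Arc T u v → Arc (D ⊕ D′) (embed u) (embed v)
  embed-arc u v a =
    subst₂ (sumArc D D′)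
      (sym (splitAt-join m′ n′ (f⊎g (splitAt m u))))
      (sym (splitAt-join m′ n′ (f⊎g (splitAt m v))))
      (arc-⊎ (splitAt m u) (splitAt m v)
        (subst₂ (Arc T) (sym (join-splitAt m n u)) (sym (join-splitAt m n v)) a))

sumT₂-contains-tournaments : ∀ s {n} → n ≤ twice s →
                             (T : Digraph n) → IsTournament T → T ⊆D sumT₂ s
sumT₂-contains-tournaments s       {zero}        _               T _  = empty-⊆D T (sumT₂ s)
sumT₂-contains-tournaments (suc s) {suc zero}    _               T _  = single-⊆D T (sumT₂ (suc s))
sumT₂-contains-tournaments (suc s) {suc (suc n)} (s≤s (s≤s n≤)) T tT =
  ⊆D-⊕ T (tournament₂-⊆D-T₂ (induced (_↑ˡ n) T)
           (induced-isTournament (↑ˡ-injective n _ _) T tT))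
         (sumT₂-contains-tournaments s n≤ (induced (2 ↑ʳ_) T)
           (induced-isTournament (↑ʳ-injective 2 _ _) T tT))

T₁⊕sumT₂-contains-tournaments : ∀ s {n} → n ≤ suc (twice s) →
                                (T : Digraph n) → IsTournament T → T ⊆D (T₁ ⊕ sumT₂ s)
T₁⊕sumT₂-contains-tournaments s {zero}  _        T _  = empty-⊆D T (T₁ ⊕ sumT₂ s)
T₁⊕sumT₂-contains-tournaments s {suc n} (s≤s n≤) T tT =
  ⊆D-⊕ T (single-⊆D (induced (_↑ˡ n) T) T₁)
         (sumT₂-contains-tournaments s n≤ (induced (1 ↑ʳ_) T)
           (induced-isTournament (↑ʳ-injective 1 _ _) T tT))

twice≡2* : ∀ s → twice s ≡ 2 * s
twice≡2* zero    = refl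
twice≡2* (suc s) = trans (cong (λ k → suc (suc k)) (twice≡2* s)) (sym (*-distribˡ-+ 2 1 s))

proposition2p3 : (s : ℕ) →
    ((n : ℕ) → n ≤ 2 * s → (T : Digraph n) → IsTournament T → T ⊆D sumT₂ s)
    × ((n : ℕ) → n ≤ suc (2 * s) → (T : Digraph n) → IsTournament T → T ⊆D (T₁ ⊕ sumT₂ s))
proposition2p3 s rewrite sym (twice≡2* s) =
  (λ _ → sumT₂-contains-tournaments s) , (λ _ → T₁⊕sumT₂-contains-tournaments s)
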